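{- If $\overline{\alpha}_R$ is residuated in the $k$-th argument place, then $\beta^k_{R/}$ is its residual and $ \beta^k_{R/}(\vec{E}[G]_k)$ is a Galois set, i.e. the union in the definition $\beta^k_{R/}(\vec{E}[G]_k)=\bigcup\{F\in\mathcal{G}(Z_{i_k})\mid\alpha_R(\vec{E}[F]_k)\subseteq G\}$ is actually a join in $\mathcal{G}(Z_{i_k})$.
   Context: Let $(X,I,Y)$ be a polarity: nonempty sets $Z_1=X$, $Z_\partial=Y$ and a relation $I\subseteq X\times Y$, inducing the Galois connection $U^{\perp}=\{y\in Y\mid \forall x\in U\; xIy\}$, ${}^{\perp}V=\{x\in X\mid \forall y\in V\; xIy\}$. Galois sets are the stable sets $A={}^{\perp}(A^{\perp})\subseteq X$ and co-stable sets $B=({}^{\perp}B)^{\perp}\subseteq Y$, forming complete lattices $\mathcal{G}(Z_1)=\mathcal G(X)$, $\mathcal{G}(Z_\partial)=\mathcal G(Y)$; $W'$ denotes $W^{\perp}$ or ${}^{\perp}W$ according to whether $W\subseteq X$ or $W\subseteq Y$. Let $R\subseteq Z_{i_{n+1}}\times\prod_{j=1}^n Z_{i_j}$ ($i_j\in\{1,\partial\}$) be a relation with image operator $\alpha_R(\vec{W})=\bigcup_{\vec{w}\in\vec{W}}R\vec{w}$, and $\overline{\alpha}_R(\vec{F})=(\alpha_R(\vec{F}))''$ for Galois sets $F_j\in\mathcal{G}(Z_{i_j})$. $\vec{E}[F]_k$ is the tuple $\vec E$ with $k$-th component replaced by $F$. For Galois sets $E_j$ and $G\in\mathcal G(Z_{i_{n+1}})$,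 $\beta^k_{R/}(\vec{E}[G]_k)=\bigcup\{F\in\mathcal{G}(Z_{i_k})\mid\alpha_R(\vec{E}[F]_k)\subseteq G\}$ (the restriction to Galois sets of the $k$-residual of $\alpha_R$). -}

module Defs where

open import Level using (Level; _⊔_; suc)
open import Data.Nat using (ℕ)
open import Data.Fin using (Fin; _≟_)
open import Data.Product using (Σ; ∃; _×_; _,_)
open import Relation.Unary using (Pred; _⊆_; _∈_)
open import Relation.Nullary using (yes; no)
open import Relation.Binary.PropositionalEquality using (refl)
open import Function.Bundles using (_⇔_)

-- A polarity (X, I, Y); nonemptiness of X and Y is recorded by points.
record Polarity (ℓ : Level) : Set (suc ℓ) where
  field
    X : Set ℓ
    Y : Set ℓ
    I : X → Y → Set ℓ
    x₀ : X
    y₀ : Y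

data Sort : Set where
  𝟙 ∂ : Sort

module _ {ℓ} (P : Polarity ℓ) where
  open Polarity P

  Z : Sort → Set ℓ
  Z 𝟙 = X
  Z ∂ = Y

  _⊥ʳ : ∀ {ℓ'} → Pred X ℓ' → Pred Y (ℓ ⊔ ℓ')
  (U ⊥ʳ) y = ∀ x → U x → I x y

  ⊥ˡ_ : ∀ {ℓ'} → Pred Y ℓ' → Pred X (ℓ ⊔ ℓ')
  (⊥ˡ V) x = ∀ y → V y → I x y

  cl : ∀ {ℓ'} (s : Sort) → Pred (Z s) ℓ' → Pred (Z s) (ℓ ⊔ ℓ')
  cl 𝟙 A = ⊥ˡ (A ⊥ʳ)
  cl ∂ B = (⊥ˡ B) ⊥ʳ

  IsGalois : ∀ {ℓ'} (s : Sort) → Pred (Z s) ℓ' → Set (ℓ ⊔ ℓ')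
  IsGalois s A = (cl s A ⊆ A) × (A ⊆ cl s A)

  module _ {n : ℕ} (i : Fin n → Sort) (o : Sort)
           (R : Z o → ((j : Fin n) → Z (i j)) → Set ℓ) where

    Tuple : ∀ ℓ' → Set (ℓ ⊔ suc ℓ')
    Tuple ℓ' = (j : Fin n) → Pred (Z (i j)) ℓ'

    αR : ∀ {ℓ'} → Tuple ℓ' → Pred (Z o) (ℓ ⊔ ℓ')
    αR W z = Σ ((j : Fin n) → Z (i j)) λ w → ((j : Fin n) → W j (w j)) × R z w

    αR̄ : ∀ {ℓ'} → Tuple ℓ' → Pred (Z o) (ℓ ⊔ ℓ')
    αR̄ W = cl o (αR W)

    upd : ∀ {ℓ'} → Tuple ℓ' → (k : Fin n) → Pred (Z (i k)) ℓ' → Tuple ℓ'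
    upd E k F j with j ≟ k
    ... | yes refl = F
    ... | no _ = E j

    βR : (E : Tuple ℓ) (k : Fin n) (G : Pred (Z o) ℓ) → Pred (Z (i k)) (suc ℓ)
    βR E k G z = Σ (Pred (Z (i k)) ℓ) λ F →
      IsGalois (i k) F × (αR (upd E k F) ⊆ G) × (z ∈ F)

    GaloisTuple : Tuple ℓ → Set ℓ
    GaloisTuple E = (j : Fin n) → IsGalois (i j) (E j)

    ResiduatedAt : (k : Fin n) → Set (suc ℓ)
    ResiduatedAt k = (E : Tuple ℓ) → GaloisTuple E →
      Σ (Pred (Z o) ℓ → Pred (Z (i k)) ℓ) λ h →
        (G : Pred (Z o) ℓ) → IsGalois o G →
          IsGalois (i k) (h G) ×
          ((F : Pred (Z (i k)) ℓ) → IsGalois (i k) F →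
             (αR̄ (upd E k F) ⊆ G) ⇔ (F ⊆ h G))

{-# OPTIONS --safe #-}
module Submission where

-- The residual h of F ↦ ᾱ_R(E⃗[F]_k) at a Galois set G is itself a Galois
-- set F with α_R(E⃗[F]_k) ⊆ G, and it contains every such F; so the union
-- β^k_{R/}(E⃗[G]_k) of all of them is exactly h(G), and both claims are
-- inherited from h.

open import Defs
open import Level using (Level)
open import Data.Nat using (ℕ)
open import Data.Fin using (Fin)
open import Data.Product using (_×_; _,_)
open import Relation.Unary using (Pred; _⊆_; _≐_)
open import Function.Base using (_∘_; id)
open import Function.Bundles using (_⇔_; mk⇔; Equivalence)
import Function.Properties.Equivalence as ⇔

⊆-resp-≐ʳ : ∀ {a b c d} {A : Set a} {F : Pred A b} {B : Pred A c} {C : Pred A d} →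
  B ≐ C → (F ⊆ B) ⇔ (F ⊆ C)
⊆-resp-≐ʳ {F = F} (B⊆C , C⊆B) = mk⇔ (widen B⊆C) (widen C⊆B)
  where
  widen : ∀ {e f} {D : Pred _ e} {D′ : Pred _ f} → D ⊆ D′ → F ⊆ D → F ⊆ D′
  widen D⊆D′ F⊆D x∈F = D⊆D′ (F⊆D x∈F)

module _ {ℓ : Level} (P : Polarity ℓ) where

  cl-monotone : ∀ {a b} (s : Sort) {A : Pred (Z P s) a} {B : Pred (Z P s) b} →
    A ⊆ B → cl P s A ⊆ cl P s B
  cl-monotone 𝟙 A⊆B x∈clA y y∈A⊥ = x∈clA y (λ x x∈A → y∈A⊥ x (A⊆B x∈A))
  cl-monotone ∂ A⊆B y∈clA x x∈⊥A = y∈clA x (λ y y∈A → x∈⊥A y (A⊆B y∈A))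

  cl-extensive : ∀ {a} (s : Sort) {A : Pred (Z P s) a} → A ⊆ cl P s A
  cl-extensive 𝟙 {x = x} x∈A y y∈A⊥ = y∈A⊥ x x∈A
  cl-extensive ∂ {x = y} y∈A x x∈⊥A = x∈⊥A y y∈A

  IsGalois-resp-≐ : ∀ {a b} (s : Sort) {A : Pred (Z P s) a} {B : Pred (Z P s) b} →
    A ≐ B → IsGalois P s A → IsGalois P s B
  IsGalois-resp-≐ s (A⊆B , B⊆A) (clA⊆A , A⊆clA) =
    A⊆B ∘ clA⊆A ∘ cl-monotone s B⊆A , cl-monotone s A⊆B ∘ A⊆clA ∘ B⊆A

  ⊆-galois⇔cl-⊆ : ∀ {a} (s : Sort) {A : Pred (Z P s) a} {G : Pred (Z P s) ℓ} →
    IsGalois P s G → (A ⊆ G) ⇔ (cl P s A ⊆ G)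
  ⊆-galois⇔cl-⊆ s {A} {G} (clG⊆G , _) = mk⇔ cl-⊆ (λ clA⊆G → clA⊆G ∘ cl-extensive s)
    where
    cl-⊆ : A ⊆ G → cl P s A ⊆ G
    cl-⊆ A⊆G = clG⊆G ∘ cl-monotone s A⊆G

  module _ {n : ℕ} (i : Fin n → Sort) (o : Sort)
           (R : Z P o → ((j : Fin n) → Z P (i j)) → Set ℓ)
           (E : Tuple P i o R ℓ) (k : Fin n)
           {G : Pred (Z P o) ℓ} (G-galois : IsGalois P o G) where

    residual≐βR : {H : Pred (Z P (i k)) ℓ} → IsGalois P (i k) H →
      ((F : Pred (Z P (i k)) ℓ) → IsGalois P (i k) F →
         (αR̄ P i o R (upd P i o R E k F) ⊆ G) ⇔ (F ⊆ H)) →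
      H ≐ βR P i o R E k G
    residual≐βR {H} H-galois residual = H⊆β , β⊆H
      where
      α⊆G⇔⊆H : (F : Pred (Z P (i k)) ℓ) → IsGalois P (i k) F →
        (αR P i o R (upd P i o R E k F) ⊆ G) ⇔ (F ⊆ H)
      α⊆G⇔⊆H F F-galois = ⇔.trans (⊆-galois⇔cl-⊆ o G-galois) (residual F F-galois)

      β⊆H : βR P i o R E k G ⊆ H
      β⊆H (F , F-galois , αF⊆G , z∈F) = Equivalence.to (α⊆G⇔⊆H F F-galois) αF⊆G z∈F

      H⊆β : H ⊆ βR P i o R E k G
      H⊆β z∈H = H , H-galois , Equivalence.from (α⊆G⇔⊆H H H-galois) id , z∈H

theorem2p13 : {ℓ : Level} (P : Polarity ℓ) {n : ℕ} (i : Fin n → Sort) (o : Sort)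
    (R : Z P o → ((j : Fin n) → Z P (i j)) → Set ℓ) (k : Fin n) →
    ResiduatedAt P i o R k →
    (E : Tuple P i o R ℓ) → GaloisTuple P i o R E →
    (G : Pred (Z P o) ℓ) → IsGalois P o G →
    IsGalois P (i k) (βR P i o R E k G) ×
    ((F : Pred (Z P (i k)) ℓ) → IsGalois P (i k) F →
    (αR̄ P i o R (upd P i o R E k F) ⊆ G) ⇔ (F ⊆ βR P i o R E k G))
theorem2p13 P i o R k residuated E E-galois G G-galois =
  let h , h-spec = residuated E E-galois
      hG-galois , residual = h-spec G G-galois
      hG≐β = residual≐βR P i o R E k G-galois hG-galois residual
  in IsGalois-resp-≐ P (i k) hG≐β hG-galois ,
     λ F F-galois → ⇔.trans (residual F F-galois) (⊆-resp-≐ʳ hG≐β)
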